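{- For every integer $n\ge 3$, the square $C_n^2$ of the cycle $C_n$ is odd prime if and only if $n\not\equiv 2\pmod 3$.
   Context: All graphs are finite and simple. An odd prime labeling of a graph $G$ with $N$ vertices is a bijection $\ell:V(G)\to\{1,3,\dots,2N-1\}$ such that $\gcd(\ell(u),\ell(v))=1$ for every edge $uv$; $G$ is odd prime if it has one. $C_n$ is the cycle on $n$ vertices. For a graph $G$ and $k\ge 1$, the $k$th power $G^k$ has the same vertex set as $G$, with distinct vertices $u,v$ adjacent iff their distance in $G$ is at most $k$. -}

module Defs where

open import Data.Nat using (ℕ; zero; suc; s≤s; _+_; _*_; _≤_; NonZero)
open import Data.Nat.DivMod using (_%_; m<n⇒m%n≡m; n%n≡0)
open import Data.Nat.Properties using (<-irrefl; n<1+n; m≤n⇒m<n∨m≡n)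
open import Data.Nat.Coprimality using (Coprime)
open import Data.Fin using (Fin; toℕ)
open import Data.Product using (Σ; ∃; _×_; _,_)
open import Data.Sum using (_⊎_; inj₁; inj₂)
open import Relation.Nullary using (¬_)
open import Relation.Binary.PropositionalEquality using (_≡_; trans; cong)
import Relation.Binary.PropositionalEquality as PE
open import Data.Fin.Properties using (toℕ<n)
open import Data.Nat.Properties using (suc-injective)
open import Function.Bundles using (_⤖_; Bijection)
open import Level using (0ℓ)

record Graph (N : ℕ) : Set₁ where
  field
    Adj   : Fin N → Fin N → Set
    irrefl : ∀ {u} → ¬ Adj u u
    sym   : ∀ {u v} → Adj u v → Adj v u
open Graph public

data Walk {N : ℕ} (G : Graph N) : ℕ → Fin N → Fin N → Set where
  here : ∀ {u} → Walk G zero u u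
  step : ∀ {m u v w} → Adj G u v → Walk G m v w → Walk G (suc m) u w

DistLe : ∀ {N} → Graph N → ℕ → Fin N → Fin N → Set
DistLe G k u v = ∃ λ m → m ≤ k × Walk G m u v

CycleAdj : (n : ℕ) → .{{NonZero n}} → Fin n → Fin n → Set
CycleAdj n i j = (toℕ j ≡ suc (toℕ i) % n) ⊎ (toℕ i ≡ suc (toℕ j) % n)

private
  noLoop : ∀ m (i : Fin (suc (suc m))) → ¬ (toℕ i ≡ suc (toℕ i) % suc (suc m))
  noLoop m i e with m≤n⇒m<n∨m≡n (toℕ<n i)
  ... | inj₁ lt = <-irrefl (trans e (m<n⇒m%n≡m lt)) (n<1+n (toℕ i))
  ... | inj₂ eq = 0≢suc (trans (PE.sym (trans e (trans (cong (_% suc (suc m)) eq) (n%n≡0 (suc (suc m)))))) (suc-injective eq))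
    where
    0≢suc : ∀ {a} → ¬ (0 ≡ suc a)
    0≢suc ()

cycle : (n : ℕ) → 3 ≤ n → Graph n
cycle (suc (suc (suc m))) _ = record
  { Adj = CycleAdj (suc (suc (suc m)))
  ; irrefl = λ { {u} (inj₁ e) → noLoop (suc m) u e ; {u} (inj₂ e) → noLoop (suc m) u e }
  ; sym = λ { (inj₁ e) → inj₂ e ; (inj₂ e) → inj₁ e }
  }
cycle (suc zero) (s≤s ())
cycle (suc (suc zero)) (s≤s (s≤s ()))

power : ∀ {N} → Graph N → ℕ → Graph N
power G k = record
  { Adj = λ u v → ¬ (u ≡ v) × DistLe G k u v
  ; irrefl = λ { (u≢u , _) → u≢u Relation.Binary.PropositionalEquality.refl }
  ; sym = λ { (u≢v , w) → (λ e → u≢v (Relation.Binary.PropositionalEquality.sym e)) , rev w }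
  }
  where
  postpend : ∀ {m u v w} → Walk G m u v → Adj G v w → Walk G (suc m) u w
  postpend here a = step a here
  postpend (step a p) b = step a (postpend p b)
  revW : ∀ {m u v} → Walk G m u v → Walk G m v u
  revW here = here
  revW (step a p) = postpend (revW p) (Graph.sym G a)
  rev : ∀ {k u v} → DistLe G k u v → DistLe G k v u
  rev (m , le , p) = m , le , revW p

oddLabel : ∀ {N} → Fin N → ℕ
oddLabel i = 2 * toℕ i + 1

-- An odd prime labeling: a bijection V(G) → {1,3,...,2N-1}
-- (encoded as a bijection Fin N ⤖ Fin N composed with oddLabel)
-- with adjacent vertices receiving coprime labels.
IsOddPrime : ∀ {N} → Graph N → Set
IsOddPrime {N} G =
  Σ (Fin N ⤖ Fin N) λ ℓ →
    ∀ u v → Adj G u v →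
      Coprime (oddLabel (Bijection.to ℓ u)) (oddLabel (Bijection.to ℓ v))

-- Give vertex i of C_n the label 2i+1. Vertices one or two steps apart
-- get labels differing by 2 or 4, hence coprime, and across the wrap-around the
-- label 1 is involved, except for the pair (n-1, 1) with labels 2n-1 and 3; these
-- are coprime exactly when n ≢ 2 (mod 3). Conversely, if n = 3q+2, the q+1 labels
-- divisible by 3 must sit on pairwise non-adjacent vertices of C_n^2, but such a set
-- has at most n/3 elements: the arcs {v, v+1, v+2} it spans are pairwise disjoint.
module Submission where

open import Defs hiding (sym)
open import Data.Nat using (ℕ; zero; suc; _≤_; _+_; _*_; _∸_; _<_; z≤n; s≤s; s≤s⁻¹; NonZero; _<?_; _/_)
open import Data.Nat.Properties
  using (+-assoc; +-comm; +-identityʳ; ≤-refl; ≤-trans; ≤-reflexive; ≤-total; ≤-antisym; ≮⇒≥; <⇒≱;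
         1+n≰n; +-monoʳ-<; +-cancelʳ-<; *-monoˡ-≤; *-cancelʳ-≡; m∸n≤m; m∸n+n≡m; m+[n∸m]≡n; +-mono-≤-<; m∸n≡0⇒m≤n;
         m<n+o⇒m∸n<o; suc-injective)
open import Data.Nat.DivMod
  using (_%_; %-distribˡ-+; m%n%n≡m%n; [m+kn]%n≡m%n; m%n<n; m<n⇒m%n≡m; m≤n⇒[n∸m]%m≡n%m; m*n%n≡0;
         %-pred-≡0; m≡m%n+[m/n]*n)
open import Data.Nat.Divisibility using (_∣_; divides; ∣-refl; ∣-trans; ∣⇒≤; ∣m∣n⇒∣m+n; ∣m+n∣m⇒∣n; m∣m*n;
         m%n≡0⇒n∣m; n∣m⇒m%n≡0)
open import Data.Nat.Coprimality using (Coprime; coprime-+; coprime-divisor; coprime?; 1-coprimeTo)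
import Data.Nat.Coprimality as Coprime
open import Data.Nat.Primality using (Prime; prime?; prime[2]; prime⇒irreducible)
open import Data.Nat.Tactic.RingSolver using (solve-∀)
open import Data.Fin using (Fin; toℕ; fromℕ<; combine; remQuot)
open import Data.Fin.Properties using (toℕ<n; toℕ-fromℕ<; toℕ-injective; combine-remQuot; injective⇒≤)
open import Data.Product using (Σ; _×_; _,_; uncurry)
open import Data.Product.Properties using (×-≡,≡→≡)
open import Data.Sum using (_⊎_; inj₁; inj₂; [_,_]′)
open import Data.Empty using (⊥-elim)
open import Relation.Nullary using (¬_; yes; no; contradiction)
open import Relation.Nullary.Decidable using (from-yes)
open import Relation.Binary.PropositionalEquality using (_≡_; _≢_; refl; sym; trans; cong; subst; module ≡-Reasoning)
open import Function using (_∘_)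
open import Function.Bundles using (_⇔_; Bijection; Surjection; mk⇔)
open import Function.Definitions using (Injective)
open import Function.Construct.Identity using (⤖-id)

open ≡-Reasoning

[m+n%d]%d≡[m+n]%d : ∀ m n d .{{_ : NonZero d}} → (m + n % d) % d ≡ (m + n) % d
[m+n%d]%d≡[m+n]%d m n d = begin
  (m + n % d) % d          ≡⟨ %-distribˡ-+ m (n % d) d ⟩
  (m % d + n % d % d) % d  ≡⟨ cong (λ x → (m % d + x) % d) (m%n%n≡m%n n d) ⟩
  (m % d + n % d) % d      ≡⟨ %-distribˡ-+ m n d ⟨
  (m + n) % d              ∎

[m+n]%d≡[m+o]%d⇒n%d≡o%d : ∀ m {n o} d .{{_ : NonZero d}} → (m + n) % d ≡ (m + o) % d → n % d ≡ o % d
[m+n]%d≡[m+o]%d⇒n%d≡o%d m {n} {o} d@(suc e) eq = begin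
  n % d                      ≡⟨ undo n ⟨
  (e * m + (m + n) % d) % d  ≡⟨ cong (λ x → (e * m + x) % d) eq ⟩
  (e * m + (m + o) % d) % d  ≡⟨ undo o ⟩
  o % d                      ∎
  where
  rearrange : ∀ e m x → e * m + (m + x) ≡ x + m * suc e
  rearrange = solve-∀
  undo : ∀ x → (e * m + (m + x) % d) % d ≡ x % d
  undo x = begin
    (e * m + (m + x) % d) % d  ≡⟨ [m+n%d]%d≡[m+n]%d (e * m) (m + x) d ⟩
    (e * m + (m + x)) % d      ≡⟨ cong (_% d) (rearrange e m x) ⟩
    (x + m * d) % d            ≡⟨ [m+kn]%n≡m%n x m d ⟩
    x % d                      ∎

m<n+n⇒m%n≡m⊎m%n+n≡m : ∀ {m n} .{{_ : NonZero n}} → m < n + n → m % n ≡ m ⊎ m % n + n ≡ m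
m<n+n⇒m%n≡m⊎m%n+n≡m {m} {n} m<n+n with m <? n
... | yes m<n = inj₁ (m<n⇒m%n≡m m<n)
... | no m≮n = inj₂ (begin
  m % n + n        ≡⟨ cong (_+ n) (m≤n⇒[n∸m]%m≡n%m n≤m) ⟨
  (m ∸ n) % n + n  ≡⟨ cong (_+ n) (m<n⇒m%n≡m (m<n+o⇒m∸n<o m n m<n+n)) ⟩
  m ∸ n + n        ≡⟨ m∸n+n≡m n≤m ⟩
  m                ∎)
  where
  n≤m : n ≤ m
  n≤m = ≮⇒≥ m≮n

prime∤⇒coprime : ∀ {p m} → Prime p → ¬ p ∣ m → Coprime m p
prime∤⇒coprime p ¬p∣m (d∣m , d∣p) with prime⇒irreducible p d∣p
... | inj₁ d≡1 = d≡1
... | inj₂ refl = contradiction d∣m ¬p∣m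

coprime-*ʳ : ∀ {m n o} → Coprime m n → Coprime m o → Coprime m (n * o)
coprime-*ʳ {n = n} m⊥n m⊥o {d} (d∣m , d∣n*o) = m⊥o (d∣m , coprime-divisor d⊥n d∣n*o)
  where
  d⊥n : Coprime d n
  d⊥n (e∣d , e∣n) = m⊥n (∣-trans e∣d d∣m , e∣n)

odd-coprime-2 : ∀ a → Coprime (2 * a + 1) 2
odd-coprime-2 a = prime∤⇒coprime prime[2] λ 2∣odd →
  contradiction (∣⇒≤ (∣m+n∣m⇒∣n 2∣odd (m∣m*n a))) λ { (s≤s ()) }

odd-coprime-+ : ∀ a d → Coprime (2 * a + 1) (2 * d) → Coprime (2 * a + 1) (2 * (d + a) + 1)
odd-coprime-+ a d a⊥d = subst (Coprime (2 * a + 1)) (shift a d) (Coprime.sym (coprime-+ (Coprime.sym a⊥d)))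
  where
  shift : ∀ a d → 2 * a + 1 + 2 * d ≡ 2 * (d + a) + 1
  shift = solve-∀

odd-coprime-2* : ∀ a {d} → d ≡ 1 ⊎ d ≡ 2 → Coprime (2 * a + 1) (2 * d)
odd-coprime-2* a (inj₁ refl) = odd-coprime-2 a
odd-coprime-2* a (inj₂ refl) = coprime-*ʳ (odd-coprime-2 a) (odd-coprime-2 a)

3∣2m+1⇒[1+m]%3≡2 : ∀ m → 3 ∣ 2 * m + 1 → suc m % 3 ≡ 2
3∣2m+1⇒[1+m]%3≡2 m 3∣odd = %-pred-≡0 {suc m} (n∣m⇒m%n≡0 (2 + m) 3 3∣2+m)
  where
  regroup : ∀ m → 2 * m + 1 + 3 ≡ 2 * (2 + m)
  regroup = solve-∀
  3∣2+m : 3 ∣ 2 + m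
  3∣2+m = coprime-divisor (from-yes (coprime? 3 2))
    (subst (3 ∣_) (regroup m) (∣m∣n⇒∣m+n 3∣odd ∣-refl))

Independent : ∀ {N k} → Graph N → (Fin k → Fin N) → Set
Independent G f = Injective _≡_ _≡_ f × (∀ i j → ¬ Adj G (f i) (f j))

-- f t is the vertex labelled 2 (3t + 1) + 1 = 3 (2t + 1).
oddPrime⇒independent : ∀ {N} (G : Graph N) k → k * 3 ≤ suc N → IsOddPrime G → Σ (Fin k → Fin N) (Independent G)
oddPrime⇒independent {N} G k k*3≤1+N (ℓ , coprime) = f , f-injective , f-independent
  where
  open Surjection (Bijection.surjection ℓ) using (to; to⁻; to∘to⁻)
  index<N : (t : Fin k) → suc (toℕ t * 3) < N
  index<N t = s≤s⁻¹ (≤-trans (*-monoˡ-≤ 3 (toℕ<n t)) k*3≤1+N)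
  index : Fin k → Fin N
  index t = fromℕ< (index<N t)
  f : Fin k → Fin N
  f = to⁻ ∘ index
  triple : ∀ t → 2 * suc (t * 3) + 1 ≡ (2 * t + 1) * 3
  triple = solve-∀
  3∣label : ∀ t → 3 ∣ oddLabel (to (f t))
  3∣label t = divides (2 * toℕ t + 1) (begin
    oddLabel (to (f t))        ≡⟨ cong (λ x → 2 * toℕ x + 1) (to∘to⁻ (index t)) ⟩
    2 * toℕ (index t) + 1      ≡⟨ cong (λ x → 2 * x + 1) (toℕ-fromℕ< (index<N t)) ⟩
    2 * suc (toℕ t * 3) + 1    ≡⟨ triple (toℕ t) ⟩
    (2 * toℕ t + 1) * 3        ∎)
  f-independent : ∀ i j → ¬ Adj G (f i) (f j)
  f-independent i j adj with coprime (f i) (f j) adj (3∣label i , 3∣label j)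
  ... | ()
  f-injective : Injective _≡_ _≡_ f
  f-injective {i} {j} fi≡fj = toℕ-injective (*-cancelʳ-≡ (toℕ i) (toℕ j) 3 (suc-injective (begin
    suc (toℕ i * 3)  ≡⟨ toℕ-fromℕ< (index<N i) ⟨
    toℕ (index i)    ≡⟨ cong toℕ (to∘to⁻ (index i)) ⟨
    toℕ (to (f i))   ≡⟨ cong (toℕ ∘ to) fi≡fj ⟩
    toℕ (to (f j))   ≡⟨ cong toℕ (to∘to⁻ (index j)) ⟩
    toℕ (index j)    ≡⟨ toℕ-fromℕ< (index<N j) ⟩
    suc (toℕ j * 3)  ∎)))

injective₂⇒*≤ : ∀ {a b c} (g : Fin a → Fin b → Fin c) →
  (∀ {i i' j j'} → g i j ≡ g i' j' → i ≡ i' × j ≡ j') → a * b ≤ c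
injective₂⇒*≤ {a} {b} g g-injective = injective⇒≤ {f = uncurry g ∘ remQuot {a} b} λ {x} {y} eq → begin
  x                                  ≡⟨ combine-remQuot {a} b x ⟨
  uncurry combine (remQuot {a} b x)  ≡⟨ cong (uncurry combine) (×-≡,≡→≡ (g-injective eq)) ⟩
  uncurry combine (remQuot {a} b y)  ≡⟨ combine-remQuot {a} b y ⟩
  y                                  ∎

module _ {n : ℕ} .{{_ : NonZero n}} where

  infixl 6 _⊕_

  _⊕_ : Fin n → ℕ → Fin n
  u ⊕ d = fromℕ< (m%n<n (d + toℕ u) n)

  toℕ-⊕ : ∀ u d → toℕ (u ⊕ d) ≡ (d + toℕ u) % n
  toℕ-⊕ u d = toℕ-fromℕ< (m%n<n (d + toℕ u) n)

  toℕ%n≡toℕ : ∀ (u : Fin n) → toℕ u % n ≡ toℕ u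
  toℕ%n≡toℕ u = m<n⇒m%n≡m (toℕ<n u)

  ⊕-identityʳ : ∀ u → u ⊕ 0 ≡ u
  ⊕-identityʳ u = toℕ-injective (trans (toℕ-⊕ u 0) (toℕ%n≡toℕ u))

  ⊕-assoc : ∀ u c d → u ⊕ c ⊕ d ≡ u ⊕ (d + c)
  ⊕-assoc u c d = toℕ-injective (begin
    toℕ (u ⊕ c ⊕ d)            ≡⟨ toℕ-⊕ (u ⊕ c) d ⟩
    (d + toℕ (u ⊕ c)) % n      ≡⟨ cong (λ x → (d + x) % n) (toℕ-⊕ u c) ⟩
    (d + (c + toℕ u) % n) % n  ≡⟨ [m+n%d]%d≡[m+n]%d d (c + toℕ u) n ⟩
    (d + (c + toℕ u)) % n      ≡⟨ cong (_% n) (+-assoc d c (toℕ u)) ⟨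
    (d + c + toℕ u) % n        ≡⟨ toℕ-⊕ u (d + c) ⟨
    toℕ (u ⊕ (d + c))          ∎)

  ⊕-cancelʳ : ∀ {u v} d → u ⊕ d ≡ v ⊕ d → u ≡ v
  ⊕-cancelʳ {u} {v} d eq = toℕ-injective (begin
    toℕ u      ≡⟨ toℕ%n≡toℕ u ⟨
    toℕ u % n  ≡⟨ [m+n]%d≡[m+o]%d⇒n%d≡o%d d n (begin
                    (d + toℕ u) % n  ≡⟨ toℕ-⊕ u d ⟨
                    toℕ (u ⊕ d)      ≡⟨ cong toℕ eq ⟩
                    toℕ (v ⊕ d)      ≡⟨ toℕ-⊕ v d ⟩
                    (d + toℕ v) % n  ∎) ⟩
    toℕ v % n  ≡⟨ toℕ%n≡toℕ v ⟩
    toℕ v      ∎)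

  ⊕-fixed⇒∣ : ∀ u d → u ⊕ d ≡ u → n ∣ d
  ⊕-fixed⇒∣ u d eq = m%n≡0⇒n∣m d n (trans d%n≡0%n (m*n%n≡0 0 n))
    where
    d%n≡0%n : d % n ≡ 0 % n
    d%n≡0%n = [m+n]%d≡[m+o]%d⇒n%d≡o%d (toℕ u) n (begin
      (toℕ u + d) % n  ≡⟨ cong (_% n) (+-comm (toℕ u) d) ⟩
      (d + toℕ u) % n  ≡⟨ toℕ-⊕ u d ⟨
      toℕ (u ⊕ d)      ≡⟨ cong toℕ eq ⟩
      toℕ u            ≡⟨ toℕ%n≡toℕ u ⟨
      toℕ u % n        ≡⟨ cong (_% n) (+-identityʳ (toℕ u)) ⟨
      (toℕ u + 0) % n  ∎)

  ⊕-moves : ∀ {u} d .{{_ : NonZero d}} → d < n → u ⊕ d ≢ u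
  ⊕-moves {u} d d<n eq = <⇒≱ d<n (∣⇒≤ (⊕-fixed⇒∣ u d eq))

module CycleSquare (m : ℕ) where

  n : ℕ
  n = 3 + m

  C : Graph n
  C = cycle n (s≤s (s≤s (s≤s z≤n)))

  C² : Graph n
  C² = power C 2

  adj-⊕1 : ∀ u → Adj C u (u ⊕ 1)
  adj-⊕1 u = inj₁ (toℕ-⊕ u 1)

  adj⇒⊕1 : ∀ {u v} → Adj C u v → v ≡ u ⊕ 1 ⊎ u ≡ v ⊕ 1
  adj⇒⊕1 {u} {v} (inj₁ e) = inj₁ (toℕ-injective (trans e (sym (toℕ-⊕ u 1))))
  adj⇒⊕1 {u} {v} (inj₂ e) = inj₂ (toℕ-injective (trans e (sym (toℕ-⊕ v 1))))

  Ahead : Fin n → Fin n → Set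
  Ahead u v = v ≡ u ⊕ 1 ⊎ v ≡ u ⊕ 2

  ahead⇒adj² : ∀ {u v} → u ≢ v → Ahead u v → Adj C² u v
  ahead⇒adj² {u} u≢v (inj₁ refl) = u≢v , 1 , s≤s z≤n , step (adj-⊕1 u) here
  ahead⇒adj² {u} u≢v (inj₂ refl) = u≢v , 2 , ≤-refl ,
    step (adj-⊕1 u) (subst (Walk C 1 (u ⊕ 1)) (⊕-assoc u 1 1) (step (adj-⊕1 (u ⊕ 1)) here))

  adj²⇒ahead : ∀ {u v} → Adj C² u v → Ahead u v ⊎ Ahead v u
  adj²⇒ahead (u≢u , zero , _ , here) = ⊥-elim (u≢u refl)
  adj²⇒ahead (_ , 1 , _ , step a here) with adj⇒⊕1 a
  ... | inj₁ v≡u⊕1 = inj₁ (inj₁ v≡u⊕1)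
  ... | inj₂ u≡v⊕1 = inj₂ (inj₁ u≡v⊕1)
  adj²⇒ahead {u} {v} (u≢v , 2 , _ , step {v = w} a (step b here)) with adj⇒⊕1 a | adj⇒⊕1 b
  ... | inj₁ w≡u⊕1 | inj₁ v≡w⊕1 = inj₁ (inj₂ (trans v≡w⊕1 (trans (cong (_⊕ 1) w≡u⊕1) (⊕-assoc u 1 1))))
  ... | inj₂ u≡w⊕1 | inj₂ w≡v⊕1 = inj₂ (inj₂ (trans u≡w⊕1 (trans (cong (_⊕ 1) w≡v⊕1) (⊕-assoc v 1 1))))
  ... | inj₁ w≡u⊕1 | inj₂ w≡v⊕1 = ⊥-elim (u≢v (⊕-cancelʳ 1 (trans (sym w≡u⊕1) w≡v⊕1)))
  ... | inj₂ u≡w⊕1 | inj₁ v≡w⊕1 = ⊥-elim (u≢v (trans u≡w⊕1 (sym v≡w⊕1)))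
  adj²⇒ahead (_ , suc (suc (suc _)) , s≤s (s≤s ()) , _)

  ⊕-collision : ∀ {u v} d → d ≤ 2 → u ≡ v ⊕ d → (d ≡ 0 × u ≡ v) ⊎ Adj C² v u
  ⊕-collision {v = v} 0 _ u≡v⊕0 = inj₁ (refl , trans u≡v⊕0 (⊕-identityʳ v))
  ⊕-collision 1 _ u≡v⊕1 =
    inj₂ (ahead⇒adj² (λ v≡u → ⊕-moves 1 (s≤s (s≤s z≤n)) (trans (sym u≡v⊕1) (sym v≡u))) (inj₁ u≡v⊕1))
  ⊕-collision 2 _ u≡v⊕2 =
    inj₂ (ahead⇒adj² (λ v≡u → ⊕-moves 2 (s≤s (s≤s (s≤s z≤n))) (trans (sym u≡v⊕2) (sym v≡u))) (inj₂ u≡v⊕2))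
  ⊕-collision (suc (suc (suc _))) (s≤s (s≤s ())) _

  -- The arcs f t, f t ⊕ 1, f t ⊕ 2 of an independent f are pairwise disjoint.
  independent⇒*3≤ : ∀ {k} {f : Fin k → Fin n} → Independent C² f → k * 3 ≤ n
  independent⇒*3≤ {f = f} (f-injective , f-independent) = injective₂⇒*≤ (λ t r → f t ⊕ toℕ r) arc-injective
    where
    arc-injective-≤ : ∀ {t t' r r'} → toℕ r ≤ toℕ r' → f t ⊕ toℕ r ≡ f t' ⊕ toℕ r' → t ≡ t' × r ≡ r'
    arc-injective-≤ {t} {t'} {r} {r'} r≤r' eq
      with ⊕-collision (toℕ r' ∸ toℕ r) (≤-trans (m∸n≤m (toℕ r') (toℕ r)) (s≤s⁻¹ (toℕ<n r')))
             (⊕-cancelʳ (toℕ r) (begin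
               f t ⊕ toℕ r                          ≡⟨ eq ⟩
               f t' ⊕ toℕ r'                        ≡⟨ cong (f t' ⊕_) (m+[n∸m]≡n r≤r') ⟨
               f t' ⊕ (toℕ r + (toℕ r' ∸ toℕ r))    ≡⟨ ⊕-assoc (f t') _ (toℕ r) ⟨
               f t' ⊕ (toℕ r' ∸ toℕ r) ⊕ toℕ r      ∎))
    ... | inj₁ (r'∸r≡0 , ft≡ft') = f-injective ft≡ft' , toℕ-injective (≤-antisym r≤r' (m∸n≡0⇒m≤n r'∸r≡0))
    ... | inj₂ adj = ⊥-elim (f-independent t' t adj)
    arc-injective : ∀ {t t' r r'} → f t ⊕ toℕ r ≡ f t' ⊕ toℕ r' → t ≡ t' × r ≡ r'
    arc-injective {r = r} {r'} eq with ≤-total (toℕ r) (toℕ r')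
    ... | inj₁ r≤r' = arc-injective-≤ r≤r' eq
    ... | inj₂ r'≤r with arc-injective-≤ r'≤r (sym eq)
    ...   | t'≡t , r'≡r = sym t'≡t , sym r'≡r

  oddPrime⇒%3≢2 : IsOddPrime C² → n % 3 ≢ 2
  oddPrime⇒%3≢2 oddPrime n%3≡2 =
    let _ , independent = oddPrime⇒independent C² (suc q) (≤-reflexive [1+q]*3≡1+n) oddPrime
    in 1+n≰n (subst (_≤ n) [1+q]*3≡1+n (independent⇒*3≤ independent))
    where
    q : ℕ
    q = n / 3
    [1+q]*3≡1+n : suc q * 3 ≡ suc n
    [1+q]*3≡1+n = cong suc (sym (trans (m≡m%n+[m/n]*n n 3) (cong (_+ q * 3) n%3≡2)))

  offset≤n : ∀ {d} → d ≡ 1 ⊎ d ≡ 2 → d ≤ n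
  offset≤n (inj₁ refl) = s≤s z≤n
  offset≤n (inj₂ refl) = s≤s (s≤s z≤n)

  -- r is the wrapped-around position (d + a) mod n: label 1, or label 3 when (a, d) = (n - 1, 2).
  wrapped-coprime : n % 3 ≢ 2 → ∀ {a d r} → d ≡ 1 ⊎ d ≡ 2 → r < d → r + n ≡ d + a → Coprime (2 * a + 1) (2 * r + 1)
  wrapped-coprime _ {r = 0} _ _ _ = Coprime.sym (1-coprimeTo _)
  wrapped-coprime n%3≢2 {a} {r = 1} (inj₂ refl) _ 1+n≡2+a = prime∤⇒coprime (from-yes (prime? 3)) λ 3∣2a+1 →
    n%3≢2 (subst (λ x → x % 3 ≡ 2) (sym (suc-injective 1+n≡2+a)) (3∣2m+1⇒[1+m]%3≡2 a 3∣2a+1))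
  wrapped-coprime _ {r = 1} (inj₁ refl) (s≤s ()) _
  wrapped-coprime _ {r = suc (suc _)} (inj₁ refl) (s≤s ()) _
  wrapped-coprime _ {r = suc (suc _)} (inj₂ refl) (s≤s (s≤s ())) _

  label-coprime : n % 3 ≢ 2 → ∀ {a} d → d ≡ 1 ⊎ d ≡ 2 → a < n → Coprime (2 * a + 1) (2 * ((d + a) % n) + 1)
  label-coprime n%3≢2 {a} d d∈ a<n with (d + a) % n | m<n+n⇒m%n≡m⊎m%n+n≡m {d + a} {n} (+-mono-≤-< (offset≤n d∈) a<n)
  ... | _ | inj₁ refl = odd-coprime-+ a d (odd-coprime-2* a d∈)
  ... | r | inj₂ r+n≡d+a =
    wrapped-coprime n%3≢2 d∈ (+-cancelʳ-< n r d (subst (_< d + n) (sym r+n≡d+a) (+-monoʳ-< d a<n))) r+n≡d+a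

  rotation-coprime : n % 3 ≢ 2 → ∀ u d → d ≡ 1 ⊎ d ≡ 2 → Coprime (oddLabel u) (oddLabel (u ⊕ d))
  rotation-coprime n%3≢2 u d d∈ = subst (λ x → Coprime (oddLabel u) (2 * x + 1)) (sym (toℕ-⊕ u d))
    (label-coprime n%3≢2 d d∈ (toℕ<n u))

  ahead-coprime : n % 3 ≢ 2 → ∀ {u v} → Ahead u v → Coprime (oddLabel u) (oddLabel v)
  ahead-coprime n%3≢2 {u} (inj₁ refl) = rotation-coprime n%3≢2 u 1 (inj₁ refl)
  ahead-coprime n%3≢2 {u} (inj₂ refl) = rotation-coprime n%3≢2 u 2 (inj₂ refl)

  %3≢2⇒oddPrime : n % 3 ≢ 2 → IsOddPrime C²
  %3≢2⇒oddPrime n%3≢2 = ⤖-id (Fin n) , λ u v adj →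
    [ ahead-coprime n%3≢2 {u} {v} , Coprime.sym ∘ ahead-coprime n%3≢2 {v} {u} ]′ (adj²⇒ahead adj)

mainTheorem17 : (n : ℕ) → (n3 : 3 ≤ n) →
    IsOddPrime (power (cycle n n3) 2) ⇔ (n % 3 ≢ 2)
mainTheorem17 (suc (suc (suc m))) _ = mk⇔ oddPrime⇒%3≢2 %3≢2⇒oddPrime
  where open CycleSquare m
mainTheorem17 (suc zero) (s≤s ())
mainTheorem17 (suc (suc zero)) (s≤s (s≤s ()))
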